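{- Let $G=(V,E)$ be a finite connected graph and let $s$ be an arbitrary vertex of $G$. Then for every vertex $q$ of $G$, $\Delta_q(G)\le 3\Delta_s(G)$. In particular, $\widehat{\Delta}(G)\le 3\Delta(G)$.
   Context: All graphs are finite, connected, unweighted, undirected, without loops or multiple edges; $d_G$ is the shortest-path metric and $B_r(s)=\{v: d_G(v,s)\le r\}$. For a vertex $s$ with eccentricity $r=\max_{u}d_G(s,u)$, the layers are $L^i(s)=\{u\in V: d_G(s,u)=i\}$, $i=0,\dots,r$. The layering partition $\mathcal{LP}(G,s)$ partitions each layer $L^i(s)$ into clusters such that two vertices $u,v\in L^i(s)$ lie in the same cluster if and only if they can be connected by a path in $G$ avoiding the ball $B_{i-1}(s)$. The cluster-diameter of $\mathcal{LP}(G,s)$ is $\Delta_s(G)=\max_{C\in\mathcal{LP}(G,s)}\max_{u,v\in C}d_G(u,v)$ (distances measured in $G$). Define $\Delta(G)=\min_{s\in V}\Delta_s(G)$ and $\widehat{\Delta}(G)=\max_{s\in V}\Delta_s(G)$. -}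

module Defs where

open import Data.Nat using (ℕ; zero; suc; _≤_; _<_; _*_)
open import Data.Fin using (Fin)
open import Data.Product using (Σ; _×_; ∃)
open import Data.Unit using (⊤)
open import Relation.Nullary using (¬_)
open import Level using (0ℓ)

record Graph : Set₁ where
  field
    n      : ℕ
    Adj    : Fin n → Fin n → Set
    sym    : ∀ {u v} → Adj u v → Adj v u
    irrefl : ∀ {u} → ¬ Adj u u

data Walk (G : Graph) (P : Fin (Graph.n G) → Set) :
          Fin (Graph.n G) → Fin (Graph.n G) → ℕ → Set where
  here : ∀ {u} → P u → Walk G P u u 0
  step : ∀ {u w v k} → P u → Graph.Adj G u w → Walk G P w v k →
         Walk G P u v (suc k)

Everywhere : (G : Graph) → Fin (Graph.n G) → Set
Everywhere G _ = ⊤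

Connected : Graph → Set
Connected G = ∀ u v → ∃ λ k → Walk G (Everywhere G) u v k

Dist : (G : Graph) → Fin (Graph.n G) → Fin (Graph.n G) → ℕ → Set
Dist G u v k = Walk G (Everywhere G) u v k ×
               (∀ m → Walk G (Everywhere G) u v m → k ≤ m)

-- vertex w lies outside the ball B_{i-1}(s), i.e. not d(s,w) ≤ i-1, i.e. not d(s,w) < i
OutsideBall : (G : Graph) → Fin (Graph.n G) → ℕ → Fin (Graph.n G) → Set
OutsideBall G s i w = ∀ k → Dist G s w k → ¬ (k < i)

-- u and v lie in the same cluster of layer L^i(s) in LP(G,s)
SameCluster : (G : Graph) → Fin (Graph.n G) → ℕ →
              Fin (Graph.n G) → Fin (Graph.n G) → Set
SameCluster G s i u v =
  Dist G s u i × Dist G s v i × ∃ λ k → Walk G (OutsideBall G s i) u v k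

ClusterDiamLe : (G : Graph) → Fin (Graph.n G) → ℕ → Set
ClusterDiamLe G s D =
  ∀ i u v → SameCluster G s i u v → ∀ k → Dist G u v k → k ≤ D

IsClusterDiam : (G : Graph) → Fin (Graph.n G) → ℕ → Set
IsClusterDiam G s D = ClusterDiamLe G s D × (∀ D' → ClusterDiamLe G s D' → D ≤ D')

IsMinClusterDiam : (G : Graph) → ℕ → Set
IsMinClusterDiam G D =
  (∃ λ s → IsClusterDiam G s D) × (∀ s D' → IsClusterDiam G s D' → D ≤ D')

IsMaxClusterDiam : (G : Graph) → ℕ → Set
IsMaxClusterDiam G D =
  (∃ λ s → IsClusterDiam G s D) × (∀ s D' → IsClusterDiam G s D' → D' ≤ D)

-- Fix q, a cluster of LP(G,q) in layer i, two of its vertices u, v, and take the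
-- largest j for which two of q, u, v are joined by a path staying at distance ≥ j
-- from s. The vertices of layer j of LP(G,s) that such a path can reach form a
-- cluster C of diameter ≤ Δ_s. No path between two of q, u, v can stay at
-- distance ≥ j + 1 from s, so every such path meets C: the shortest paths from q
-- to u and to v meet C in vertices z_u, z_v, and the path from u to v avoiding
-- B_{i-1}(q) meets C in a vertex w. As d(q,w) ≥ i = d(q,u) this forces
-- d(z_u,u) ≤ d(z_u,w) ≤ Δ_s, likewise d(z_v,v) ≤ Δ_s, so d(u,v) ≤ 3 Δ_s.
--
-- Adjacency is not decidable, so the argument runs in the double-negation monad
-- and is discharged at the end because _≤_ on ℕ is decidable.
module Submission where

open import Defs
open import Data.Nat using (ℕ; zero; suc; _≤_; _<_; _*_; _+_; z≤n; _≤?_; _≟_)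
open import Data.Nat.Properties
open import Data.Nat.Induction using (<-rec)
open import Data.Fin using (Fin)
open import Data.Fin.Properties using (sequence)
open import Data.Product using (_×_; Σ; ∃-syntax; _,_; proj₁; proj₂)
open import Data.Sum using (_⊎_; inj₁; inj₂)
open import Data.Unit using (tt)
open import Effect.Monad using (RawMonad)
open import Function using (_∘_)
open import Level using (0ℓ)
open import Relation.Nullary using (¬_; Dec; yes; no; contradiction)
open import Relation.Nullary.Decidable using (decidable-stable)
open import Relation.Nullary.Decidable.Core using (¬¬-excluded-middle)
open import Relation.Nullary.Negation using (¬¬-Monad)
open import Relation.Binary.PropositionalEquality using (_≡_; refl; sym; trans; cong; cong₂; subst)

open RawMonad (¬¬-Monad {0ℓ})

Least : (ℕ → Set) → ℕ → Set
Least P k = P k × (∀ j → P j → k ≤ j)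

¬¬-least : ∀ {P : ℕ → Set} {m} → P m → ¬ ¬ (∃[ k ] Least P k)
¬¬-least {P} {m} = <-rec (λ m → P m → ¬ ¬ (∃[ k ] Least P k)) lessOrLeast m
  where
  lessOrLeast : ∀ m → (∀ {j} → j < m → P j → ¬ ¬ (∃[ k ] Least P k)) → P m → ¬ ¬ (∃[ k ] Least P k)
  lessOrLeast m rec pm = ¬¬-excluded-middle {A = ∃[ j ] j < m × P j} >>= λ where
    (yes (_ , j<m , pj)) → rec j<m pj
    (no none)            → pure (m , pm , λ j pj → ≮⇒≥ (λ j<m → none (j , j<m , pj)))

¬¬-lastTrue : ∀ {P : ℕ → Set} n → P 0 → ¬ P n → ¬ ¬ (∃[ j ] P j × ¬ P (suc j))
¬¬-lastTrue zero    p₀ ¬pₙ = contradiction p₀ ¬pₙ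
¬¬-lastTrue (suc n) p₀ ¬pₙ = ¬¬-excluded-middle >>= λ where
  (yes pₙ₋₁) → pure (n , pₙ₋₁ , ¬pₙ)
  (no ¬pₙ₋₁) → ¬¬-lastTrue n p₀ ¬pₙ₋₁

module Walks {G : Graph} where
  private
    V = Fin (Graph.n G)

  head : ∀ {P x y k} → Walk G P x y k → P x
  head (here px)     = px
  head (step px _ _) = px

  map : ∀ {P P′ : V → Set} {x y k} → (∀ {z} → P z → P′ z) → Walk G P x y k → Walk G P′ x y k
  map f (here px)        = here (f px)
  map f (step px e rest) = step (f px) e (map f rest)

  forget : ∀ {P x y k} → Walk G P x y k → Walk G (Everywhere G) x y k
  forget = map (λ _ → tt)

  _++_ : ∀ {P x y z k l} → Walk G P x y k → Walk G P y z l → Walk G P x z (k + l)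
  here _         ++ w = w
  step px e rest ++ w = step px e (rest ++ w)

  _∷ʳ_ : ∀ {P x y z k} → Walk G P x y k → Graph.Adj G y z × P z → Walk G P x z (suc k)
  here py         ∷ʳ (e , pz) = step py e (here pz)
  step px e′ rest ∷ʳ edge     = step px e′ (rest ∷ʳ edge)

  reverse : ∀ {P x y k} → Walk G P x y k → Walk G P y x k
  reverse (here px)        = here px
  reverse (step px e rest) = reverse rest ∷ʳ (Graph.sym G e , px)

  record Exit (P K : V → Set) (x y : V) (m : ℕ) : Set where
    constructor exit
    field
      {inner outer} : V
      {k₁ k₂}       : ℕ
      edge          : Graph.Adj G inner outer
      inner∈K       : K inner
      outer∉K       : ¬ K outer
      before        : Walk G P x inner k₁
      after         : Walk G P outer y k₂
      length        : suc (k₁ + k₂) ≡ m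

  ¬¬-exit : ∀ {P x y m} (K : V → Set) → Walk G P x y m → K x → ¬ K y → ¬ ¬ Exit P K x y m
  ¬¬-exit K (here _) kx ¬ky = contradiction kx ¬ky
  ¬¬-exit K (step {w = w} px e rest) kx ¬ky = ¬¬-excluded-middle >>= continue
    where
    extend : ∀ {m} → Exit _ K w _ m → Exit _ K _ _ (suc m)
    extend (exit e′ k ¬k before after len) = exit e′ k ¬k (step px e before) after (cong suc len)

    continue : Dec (K w) → ¬ ¬ Exit _ K _ _ _
    continue (yes kw) = extend <$> ¬¬-exit K rest kw ¬ky
    continue (no ¬kw) = pure (exit e kx ¬kw (here px) rest refl)

open Walks

¬¬-distance : ∀ {G} → Connected G →
              ¬ ¬ (Σ (Fin (Graph.n G) → Fin (Graph.n G) → ℕ) λ d → ∀ x y → Dist G x y (d x y))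
¬¬-distance conn = do
  dist ← sequence rawApplicative λ x → sequence rawApplicative λ y → ¬¬-least (proj₂ (conn x y))
  pure ((λ x y → proj₁ (dist x y)) , λ x y → proj₂ (dist x y))

module Metric (G : Graph) (d : Fin (Graph.n G) → Fin (Graph.n G) → ℕ)
              (d-dist : ∀ x y → Dist G x y (d x y)) where
  private
    V = Fin (Graph.n G)

  shortest : ∀ x y → Walk G (Everywhere G) x y (d x y)
  shortest x y = proj₁ (d-dist x y)

  d-minimal : ∀ {P x y m} → Walk G P x y m → d x y ≤ m
  d-minimal {x = x} {y} w = proj₂ (d-dist x y) _ (forget w)

  Dist⇒≡ : ∀ {x y k} → Dist G x y k → k ≡ d x y
  Dist⇒≡ (w , minimal) = ≤-antisym (minimal _ (shortest _ _)) (d-minimal w)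

  d-sym : ∀ x y → d x y ≡ d y x
  d-sym x y = ≤-antisym (d-minimal (reverse (shortest y x))) (d-minimal (reverse (shortest x y)))

  d-triangle : ∀ x y z → d x z ≤ d x y + d y z
  d-triangle x y z = d-minimal (shortest x y ++ shortest y z)

  d-edge : ∀ {c x y} → Graph.Adj G x y → d c x ≤ suc (d c y)
  d-edge e = d-minimal (shortest _ _ ∷ʳ (Graph.sym G e , tt))

  outside⇒≤ : ∀ {s j x} → OutsideBall G s j x → j ≤ d s x
  outside⇒≤ out = ≮⇒≥ (out _ (d-dist _ _))

  ≤⇒outside : ∀ {s j x} → j ≤ d s x → OutsideBall G s j x
  ≤⇒outside j≤d k dist k<j = <⇒≱ k<j (subst (_ ≤_) (sym (Dist⇒≡ dist)) j≤d)

  module Layers (s : V) where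
    Linked : ℕ → V → V → Set
    Linked j x y = ∃[ k ] Walk G (λ w → j ≤ d s w) x y k

    linked⇒≤ : ∀ {j x y} → Linked j x y → j ≤ d s x
    linked⇒≤ (_ , w) = head w

    linked-refl : ∀ {j x} → j ≤ d s x → Linked j x x
    linked-refl j≤x = 0 , here j≤x

    linked-edge : ∀ {j x y} → Graph.Adj G x y → j ≤ d s x → j ≤ d s y → Linked j x y
    linked-edge e j≤x j≤y = 1 , step j≤x e (here j≤y)

    linked-sym : ∀ {j x y} → Linked j x y → Linked j y x
    linked-sym (_ , w) = _ , reverse w

    linked-trans : ∀ {j x y z} → Linked j x y → Linked j y z → Linked j x z
    linked-trans (_ , w) (_ , w′) = _ , w ++ w′

    linked-weaken : ∀ {j x y} → Linked (suc j) x y → Linked j x y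
    linked-weaken (_ , w) = _ , map <⇒≤ w

    linked-zero : Connected G → ∀ x y → Linked 0 x y
    linked-zero conn x y = _ , map (λ _ → z≤n) (proj₂ (conn x y))

    PairLinked : ℕ → V → V → V → Set
    PairLinked j q u v = Linked j u v ⊎ Linked j u q ⊎ Linked j v q

    module Cluster (a : ℕ) (Δₛ≤a : ClusterDiamLe G s a) (j : ℕ) (r : V) where
      InCluster : V → Set
      InCluster z = Linked j z r × d s z ≡ j

      cluster-close : ∀ {z w} → InCluster z → InCluster w → d z w ≤ a
      cluster-close {z} {w} (z~r , z-layer) (w~r , w-layer) =
        Δₛ≤a j z w (layer z-layer , layer w-layer , avoiding (linked-trans z~r (linked-sym w~r)))
             (d z w) (d-dist z w)
        where
        layer : ∀ {x} → d s x ≡ j → Dist G s x j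
        layer {x} eq = subst (Dist G s x) eq (d-dist s x)

        avoiding : Linked j z w → ∃[ k ] Walk G (OutsideBall G s j) z w k
        avoiding (_ , walk) = _ , map ≤⇒outside walk

      Meets : (V → Set) → V → V → ℕ → Set
      Meets P x y m = ∃[ z ] InCluster z × P z × d x z + d z y ≤ m

      -- Leaving the vertices linked to x at level j+1, the walk steps down to layer j.
      meets-cluster : ∀ {P x y m} → Walk G P x y m → Linked j x r → ¬ Linked (suc j) x y →
                      ¬ ¬ Meets P x y m
      meets-cluster {x = x} W x~r ¬x~y with d s x ≟ j
      ... | yes x-layer = pure (x , (x~r , x-layer) , head W , +-mono-≤ (d-minimal (here tt)) (d-minimal W))
      ... | no x∉layer  = do
        exit e p~x ¬b~x before after len ←
          ¬¬-exit (λ t → Linked (suc j) t x) W (linked-refl j<x) (¬x~y ∘ linked-sym)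
        pure (_ , (b~r e p~x , b-layer e p~x ¬b~x) , head after ,
              subst (_ ≤_) len (+-mono-≤ (d-minimal (before ∷ʳ (e , head after))) (d-minimal after)))
        where
        j<x : suc j ≤ d s x
        j<x = ≤∧≢⇒< (linked⇒≤ x~r) (x∉layer ∘ sym)

        j≤b : ∀ {p b} → Graph.Adj G p b → Linked (suc j) p x → j ≤ d s b
        j≤b e p~x = ≤-pred (≤-trans (linked⇒≤ p~x) (d-edge e))

        b-layer : ∀ {p b} → Graph.Adj G p b → Linked (suc j) p x → ¬ Linked (suc j) b x → d s b ≡ j
        b-layer e p~x ¬b~x = ≤-antisym
          (≮⇒≥ λ j<b → ¬b~x (linked-trans (linked-edge (Graph.sym G e) j<b (linked⇒≤ p~x)) p~x))
          (j≤b e p~x)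

        b~r : ∀ {p b} → Graph.Adj G p b → Linked (suc j) p x → Linked j b r
        b~r e p~x = linked-trans (linked-edge (Graph.sym G e) (j≤b e p~x) (<⇒≤ (linked⇒≤ p~x)))
                                 (linked-trans (linked-weaken p~x) x~r)

      meets-cluster± : ∀ {P x y m} → Walk G P x y m → Linked j x r ⊎ Linked j y r →
                       ¬ Linked (suc j) x y → ¬ ¬ Meets P x y m
      meets-cluster± W (inj₁ x~r) ¬x~y = meets-cluster W x~r ¬x~y
      meets-cluster± {x = x} {y} W (inj₂ y~r) ¬x~y =
        flip <$> meets-cluster (reverse W) y~r (¬x~y ∘ linked-sym)
        where
        flip : ∀ {P m} → Meets P y x m → Meets P x y m
        flip {m = m} (z , z∈C , pz , le) = z , z∈C , pz , subst (_≤ m) reorder le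
          where
          reorder : d y z + d z x ≡ d x z + d z y
          reorder = trans (+-comm (d y z) (d z x)) (cong₂ _+_ (d-sym z x) (d-sym y z))

      near-cluster : ∀ {q x w i} → Dist G q x i → i ≤ d q w → InCluster w →
                     Linked j q r ⊎ Linked j x r → ¬ Linked (suc j) q x →
                     ¬ ¬ (∃[ z ] InCluster z × d z x ≤ a)
      near-cluster {q} {x} {w} {i} (path , _) i≤w w∈C link ¬q~x = do
        z , z∈C , _ , via-z ← meets-cluster± path link ¬q~x
        pure (z , z∈C , +-cancelˡ-≤ (d q z) _ _ (begin
          d q z + d z x ≤⟨ via-z ⟩
          i             ≤⟨ i≤w ⟩
          d q w         ≤⟨ d-triangle q z w ⟩
          d q z + d z w ≤⟨ +-monoʳ-≤ (d q z) (cluster-close z∈C w∈C) ⟩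
          d q z + a     ∎))
        where open ≤-Reasoning

      sameCluster-bound : ∀ {q i u v} → SameCluster G q i u v →
                          Linked j u r ⊎ Linked j v r → Linked j q r ⊎ Linked j u r →
                          Linked j q r ⊎ Linked j v r → ¬ PairLinked (suc j) q u v →
                          ¬ ¬ d u v ≤ 3 * a
      sameCluster-bound {u = u} {v} (q~u , q~v , _ , P) u∨v q∨u q∨v ¬pair = do
        w , w∈C , w-outside , _ ← meets-cluster± P u∨v (¬pair ∘ inj₁)
        zᵤ , zᵤ∈C , zᵤ-close ← near-cluster q~u (outside⇒≤ w-outside) w∈C q∨u
                                             (¬pair ∘ inj₂ ∘ inj₁ ∘ linked-sym)
        zᵥ , zᵥ∈C , zᵥ-close ← near-cluster q~v (outside⇒≤ w-outside) w∈C q∨v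
                                             (¬pair ∘ inj₂ ∘ inj₂ ∘ linked-sym)
        pure (begin
          d u v                         ≤⟨ d-triangle u zᵤ v ⟩
          d u zᵤ + d zᵤ v               ≤⟨ +-monoʳ-≤ (d u zᵤ) (d-triangle zᵤ zᵥ v) ⟩
          d u zᵤ + (d zᵤ zᵥ + d zᵥ v)   ≤⟨ +-mono-≤ (subst (_≤ a) (d-sym zᵤ u) zᵤ-close)
                                            (+-mono-≤ (cluster-close zᵤ∈C zᵥ∈C) zᵥ-close) ⟩
          a + (a + a)                   ≡⟨ cong (λ t → a + (a + t)) (sym (+-identityʳ a)) ⟩
          3 * a                         ∎)
        where open ≤-Reasoning

    module _ (conn : Connected G) (a : ℕ) (Δₛ≤a : ClusterDiamLe G s a) where
      open Cluster a Δₛ≤a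

      pairLinked-bound : ∀ {j q u v} → PairLinked j q u v → j ≤ d s u + d s v
      pairLinked-bound (inj₁ u~v)        = ≤-trans (linked⇒≤ u~v) (m≤m+n _ _)
      pairLinked-bound (inj₂ (inj₁ u~q)) = ≤-trans (linked⇒≤ u~q) (m≤m+n _ _)
      pairLinked-bound (inj₂ (inj₂ v~q)) = ≤-trans (linked⇒≤ v~q) (m≤n+m _ _)

      sameCluster-bound-at : ∀ {q i u v} j → SameCluster G q i u v → PairLinked j q u v →
                             ¬ PairLinked (suc j) q u v → ¬ ¬ d u v ≤ 3 * a
      sameCluster-bound-at {u = u} j same (inj₁ u~v) =
        sameCluster-bound j u same (inj₁ u~u) (inj₂ u~u) (inj₂ (linked-sym u~v))
        where u~u = linked-refl (linked⇒≤ u~v)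
      sameCluster-bound-at {u = u} j same (inj₂ (inj₁ u~q)) =
        sameCluster-bound j u same (inj₁ u~u) (inj₁ (linked-sym u~q)) (inj₁ (linked-sym u~q))
        where u~u = linked-refl (linked⇒≤ u~q)
      sameCluster-bound-at {v = v} j same (inj₂ (inj₂ v~q)) =
        sameCluster-bound j v same (inj₂ v~v) (inj₁ (linked-sym v~q)) (inj₁ (linked-sym v~q))
        where v~v = linked-refl (linked⇒≤ v~q)

      sameCluster-dist≤3* : ∀ {q i u v} → SameCluster G q i u v → ¬ ¬ d u v ≤ 3 * a
      sameCluster-dist≤3* {q} {u = u} {v} same = do
        j , linked , ¬linked ← ¬¬-lastTrue {λ j → PairLinked j q u v} (suc (d s u + d s v))
                                 (inj₁ (linked-zero conn u v)) (<⇒≱ ≤-refl ∘ pairLinked-bound)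
        sameCluster-bound-at j same linked ¬linked

clusterDiamLe-3* : ∀ {G s q a} → Connected G → ClusterDiamLe G s a → ClusterDiamLe G q (3 * a)
clusterDiamLe-3* {s = s} {a = a} conn Δₛ≤a i u v same k dist = decidable-stable (k ≤? 3 * a) do
  d , d-dist ← ¬¬-distance conn
  let open Metric _ d d-dist
  d≤3a ← Layers.sameCluster-dist≤3* s conn a Δₛ≤a same
  pure (subst (_≤ 3 * a) (sym (Dist⇒≡ dist)) d≤3a)

proposition1 : (G : Graph) → Connected G →
    (∀ (s q : Fin (Graph.n G)) (a b : ℕ) →
       IsClusterDiam G s a → IsClusterDiam G q b → b ≤ 3 * a)
    × (∀ (d dh : ℕ) → IsMinClusterDiam G d → IsMaxClusterDiam G dh → dh ≤ 3 * d)
proposition1 G conn = comparison , λ { d dh ((s , s-diam) , _) ((q , q-diam) , _) → comparison s q d dh s-diam q-diam }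
  where
  comparison : ∀ (s q : Fin (Graph.n G)) (a b : ℕ) → IsClusterDiam G s a → IsClusterDiam G q b → b ≤ 3 * a
  comparison s q a b (Δₛ≤a , _) (_ , b-least) = b-least (3 * a) (clusterDiamLe-3* conn Δₛ≤a)
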